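{- Let $N$ be a square-free positive integer that is a congruent number, and let $\alpha_1/\alpha_2$ and $\beta_1/\beta_2$ be the legs of a right triangle with rational sides and area $N$, where $\alpha_1,\alpha_2,\beta_1,\beta_2$ are positive integers with $\gcd(\alpha_1,\alpha_2)=\gcd(\beta_1,\beta_2)=1$. Then $\max(\alpha_1,\alpha_2,\beta_1,\beta_2)=\max(\alpha_1,\beta_1)$.
   Context: A congruent number is a positive integer that is the area of a right triangle with rational sides. The area condition means $\frac{\alpha_1}{\alpha_2}\cdot\frac{\beta_1}{\beta_2}=2N$. The quantity $\max(\alpha_1,\alpha_2,\beta_1,\beta_2)$ is called the height of the representation. -}

module Defs where

open import Data.Nat as ℕ using (ℕ)
open import Data.Nat.Divisibility using (_∣_)
open import Data.Nat.Primality using (Prime)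
open import Data.Integer using (+_)
open import Data.Rational using (ℚ; 0ℚ; _<_; _+_; _*_; _/_)
open import Data.Product using (Σ; ∃; _×_)
open import Relation.Nullary using (¬_)
open import Relation.Binary.PropositionalEquality using (_≡_)

SquareFree : ℕ → Set
SquareFree n = ∀ p → Prime p → ¬ (p ℕ.* p ∣ n)

toℚ : ℕ → ℚ
toℚ N = + N / 1

RightTriangleLegs : ℚ → ℚ → ℕ → Set
RightTriangleLegs a b N =
  0ℚ < a × 0ℚ < b ×
  (∃ λ c → 0ℚ < c × (a * a + b * b ≡ c * c)) ×
  (a * b ≡ toℚ (2 ℕ.* N))

Congruent : ℕ → Set
Congruent N = ∃ λ a → ∃ λ b → RightTriangleLegs a b N

-- Clearing denominators in the area equation gives α₁β₁ = 2N α₂β₂. Since α₂ is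
-- coprime to α₁ it divides β₁, so α₂ ≤ β₁; symmetrically β₂ ≤ α₁. Neither the
-- square-freeness of N nor the hypotenuse plays any role.
module Submission where

open import Defs
open import Data.Nat using (ℕ; _⊔_; NonZero)
open import Data.Nat.Coprimality using (Coprime)
open import Data.Integer using (+_)
open import Data.Rational using (_/_)
open import Relation.Binary.PropositionalEquality using (_≡_)

open import Data.Nat as ℕ using (suc; _≤_)
open import Data.Nat.Properties
  using (*-comm; *-assoc; ≤-trans; m≤m⊔n; m≤n⇒m⊔n≡n; m≥n⇒m⊔n≡m; ⊔-assoc)
open import Data.Nat.Coprimality using (coprime-divisor) renaming (sym to Coprime-sym)
open import Data.Nat.Divisibility using (_∣_; divides; ∣⇒≤)
import Data.Integer as ℤ
import Data.Integer.Properties as ℤ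
import Data.Rational as ℚ
import Data.Rational.Properties as ℚ
import Data.Rational.Unnormalised as ℚᵘ
import Data.Rational.Unnormalised.Properties as ℚᵘ
open import Data.Product using (_,_)
open import Relation.Binary.PropositionalEquality using (trans; cong; module ≡-Reasoning)

/-*-/≡toℚ⇒*≡* : ∀ a b m n c .{{_ : NonZero m}} .{{_ : NonZero n}} →
                (+ a / m) ℚ.* (+ b / n) ≡ toℚ c → a ℕ.* b ≡ c ℕ.* (m ℕ.* n)
/-*-/≡toℚ⇒*≡* a b m@(suc _) n@(suc _) c eq with unnormalised
  where
  open ℚᵘ.≃-Reasoning
  unnormalised : (+ a ℚᵘ./ m) ℚᵘ.* (+ b ℚᵘ./ n) ℚᵘ.≃ (+ c ℚᵘ./ 1)
  unnormalised = begin
    (+ a ℚᵘ./ m) ℚᵘ.* (+ b ℚᵘ./ n)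
      ≈⟨ ℚᵘ.*-cong (ℚ.toℚᵘ-fromℚᵘ (+ a ℚᵘ./ m)) (ℚ.toℚᵘ-fromℚᵘ (+ b ℚᵘ./ n)) ⟨
    ℚ.toℚᵘ (+ a / m) ℚᵘ.* ℚ.toℚᵘ (+ b / n)
      ≈⟨ ℚ.toℚᵘ-homo-* (+ a / m) (+ b / n) ⟨
    ℚ.toℚᵘ ((+ a / m) ℚ.* (+ b / n))
      ≈⟨ ℚ.toℚᵘ-cong eq ⟩
    ℚ.toℚᵘ (toℚ c)
      ≈⟨ ℚ.toℚᵘ-fromℚᵘ (+ c ℚᵘ./ 1) ⟩
    + c ℚᵘ./ 1 ∎
... | ℚᵘ.*≡* cross = ℤ.+-injective (begin
  + (a ℕ.* b)                 ≡⟨ ℤ.pos-* a b ⟩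
  + a ℤ.* + b                 ≡⟨ ℤ.*-identityʳ (+ a ℤ.* + b) ⟨
  (+ a ℤ.* + b) ℤ.* + 1       ≡⟨ cross ⟩
  + c ℤ.* + (m ℕ.* n)         ≡⟨ ℤ.pos-* c (m ℕ.* n) ⟨
  + (c ℕ.* (m ℕ.* n))         ∎)
  where open ≡-Reasoning

coprime-*≡*⇒∣ : ∀ {α₁ α₂ β₁ β₂} c → Coprime α₁ α₂ →
                α₁ ℕ.* β₁ ≡ c ℕ.* (α₂ ℕ.* β₂) → α₂ ∣ β₁
coprime-*≡*⇒∣ {α₁} {α₂} {β₁} {β₂} c α₁⊥α₂ eq =
  coprime-divisor (Coprime-sym α₁⊥α₂) (divides (c ℕ.* β₂) (begin
    α₁ ℕ.* β₁          ≡⟨ eq ⟩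
    c ℕ.* (α₂ ℕ.* β₂)  ≡⟨ cong (c ℕ.*_) (*-comm α₂ β₂) ⟩
    c ℕ.* (β₂ ℕ.* α₂)  ≡⟨ *-assoc c β₂ α₂ ⟨
    c ℕ.* β₂ ℕ.* α₂    ∎))
  where open ≡-Reasoning

m⊔n⊔o⊔p≡m⊔o : ∀ {m n o p} → n ≤ o → p ≤ m → m ⊔ n ⊔ o ⊔ p ≡ m ⊔ o
m⊔n⊔o⊔p≡m⊔o {m} {n} {o} {p} n≤o p≤m = begin
  m ⊔ n ⊔ o ⊔ p    ≡⟨ cong (_⊔ p) (⊔-assoc m n o) ⟩
  m ⊔ (n ⊔ o) ⊔ p  ≡⟨ cong (λ x → m ⊔ x ⊔ p) (m≤n⇒m⊔n≡n n≤o) ⟩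
  m ⊔ o ⊔ p        ≡⟨ m≥n⇒m⊔n≡m (≤-trans p≤m (m≤m⊔n m o)) ⟩
  m ⊔ o            ∎
  where open ≡-Reasoning

theorem2 : (N α₁ α₂ β₁ β₂ : ℕ) → .{{_ : NonZero N}} → SquareFree N → Congruent N →
    .{{_ : NonZero α₁}} → .{{_ : NonZero α₂}} → .{{_ : NonZero β₁}} → .{{_ : NonZero β₂}} →
    Coprime α₁ α₂ → Coprime β₁ β₂ →
    RightTriangleLegs (+ α₁ / α₂) (+ β₁ / β₂) N →
    α₁ ⊔ α₂ ⊔ β₁ ⊔ β₂ ≡ α₁ ⊔ β₁
theorem2 N α₁ α₂ β₁ β₂ _ _ α₁⊥α₂ β₁⊥β₂ (_ , _ , _ , area) =
  m⊔n⊔o⊔p≡m⊔o (∣⇒≤ α₂∣β₁) (∣⇒≤ β₂∣α₁)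
  where
  cleared : α₁ ℕ.* β₁ ≡ 2 ℕ.* N ℕ.* (α₂ ℕ.* β₂)
  cleared = /-*-/≡toℚ⇒*≡* α₁ β₁ α₂ β₂ (2 ℕ.* N) area
  cleared′ : β₁ ℕ.* α₁ ≡ 2 ℕ.* N ℕ.* (β₂ ℕ.* α₂)
  cleared′ = /-*-/≡toℚ⇒*≡* β₁ α₁ β₂ α₂ (2 ℕ.* N)
               (trans (ℚ.*-comm (+ β₁ / β₂) (+ α₁ / α₂)) area)
  α₂∣β₁ : α₂ ∣ β₁
  α₂∣β₁ = coprime-*≡*⇒∣ (2 ℕ.* N) α₁⊥α₂ cleared
  β₂∣α₁ : β₂ ∣ α₁
  β₂∣α₁ = coprime-*≡*⇒∣ (2 ℕ.* N) β₁⊥β₂ cleared′
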